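{- Let $n\ge2$, $i\in\{1,\dots,n-1\}$, and let $w\in S_n$ be such that $s_i$ appears with multiplicity $1$ in some reduced expression of $w$. Then there exists $w'\in S_n$ such that: (i) $s_i$ does not appear in some (equivalently any) reduced expression of $w'$; (ii) $w'w$ is of one of the following forms: $w'w=s_i$; or $w'w=s_is_{i-1}\cdots s_{i-\delta^- }$ for some $\delta^->0$; or $w'w=s_is_{i+1}\cdots s_{i+\delta^+}$ for some $\delta^+>0$; or $w'w=s_is_{i-1}\cdots s_{i-\delta^- }s_{i+1}\cdots s_{i+\delta^+}$ for some $\delta^-,\delta^+>0$ (in particular $w'w$ has a reduced expression in which each simple reflection appears at most once).
   Context: $S_n$ is the symmetric group with simple reflections $s_j=(j,j+1)$, $j=1,\dots,n-1$; reduced expressions and lengths are with respect to these generators. -}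

module Defs where

open import Data.Nat using (ℕ; zero; suc; _+_; _∸_; _≤_)
open import Data.Fin using (Fin; inject₁; toℕ) renaming (suc to fsuc)
open import Data.Fin.Permutation using (Permutation′; transpose; id; _∘ₚ_; _≈_)
open import Data.List using (List; []; _∷_; _++_; length; map)
open import Data.Product using (Σ; ∃; _×_)
open import Relation.Binary.PropositionalEquality using (_≡_)
open import Relation.Nullary using (¬_)
import Data.Nat

-- Conventions: S_n with n = suc m (m ≥ 1).  The simple reflection paper-s_j
-- (1 ≤ j ≤ n-1) is indexed by the letter k : Fin m with j = toℕ k + 1;
-- it swaps the (0-based) positions toℕ k and toℕ k + 1.

Perm : ℕ → Set
Perm m = Permutation′ (suc m)

s : ∀ {m} → Fin m → Perm m
s k = transpose (inject₁ k) (fsuc k)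

-- group product  (u · v)(x) = u (v x)   (usual composition of maps)
_·_ : ∀ {m} → Perm m → Perm m → Perm m
u · v = v ∘ₚ u

Word : ℕ → Set
Word m = List (Fin m)

eval : ∀ {m} → Word m → Perm m
eval []       = id
eval (k ∷ ws) = s k · eval ws

Reduced : ∀ {m} → Word m → Perm m → Set
Reduced {m} ws w = eval ws ≈ w × (∀ (vs : Word m) → eval vs ≈ w → length ws ≤ length vs)

mult : ∀ {m} → Fin m → Word m → ℕ
mult k []       = zero
mult k (j ∷ ws) with toℕ k Data.Nat.≟ toℕ j
... | Relation.Nullary.yes _ = suc (mult k ws)
... | Relation.Nullary.no  _ = mult k ws

desc : ℕ → ℕ → List ℕ
desc k zero    = []
desc k (suc d) = desc k d ++ (k ∸ suc d ∷ [])

asc : ℕ → ℕ → List ℕ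
asc k zero    = []
asc k (suc d) = asc k d ++ (k + suc d ∷ [])

-- v = s_i s_{i-1} ... s_{i-δ⁻} s_{i+1} ... s_{i+δ⁺} with δ⁻, δ⁺ ≥ 0
-- (δ⁻ = 0 / δ⁺ = 0 meaning the corresponding block is absent; this covers
-- exactly the four forms of the paper).  Here k is the letter for s_i;
-- the requirement i - δ⁻ ≥ 1 is δ⁻ ≤ toℕ k, and i + δ⁺ ≤ n-1 is forced by
-- the letters living in Fin m.
SpecialForm : ∀ {m} → Fin m → Perm m → Set
SpecialForm {m} k v =
  Σ ℕ λ δ⁻ → Σ ℕ λ δ⁺ → Σ (Word m) λ ws →
    δ⁻ ≤ toℕ k ×
    map toℕ ws ≡ toℕ k ∷ (desc (toℕ k) δ⁻ ++ asc (toℕ k) δ⁺) ×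
    eval ws ≈ v

{-# OPTIONS --safe #-}
-- Write the reduced word as a · s_i · b with s_i occurring neither in a nor in b.
-- Feeding the letters of b one at a time into s_i, we keep s_i · b = c · v with c
-- free of s_i and v = s_i s_{i-1}⋯s_{i-δ⁻} s_{i+1}⋯s_{i+δ⁺}: a new letter either
-- commutes past v, is conjugated by v into a neighbouring letter, or lengthens or
-- shortens one of the two runs of v, so c · v is never longer than s_i · b.  Then
-- w = (a c) · v and w′ = (a c)⁻¹ does the job: it avoids s_i, w′ w = v, and the
-- reversed word of a c is reduced, since a shorter word u for w′ would make u⁻¹ v
-- a word for w shorter than the reduced one.
module Submission where

open import Defs
open import Data.Nat using (ℕ; zero; suc; _+_; _∸_; _≤_; _<_; _≟_; s≤s; z<s; s≤s⁻¹)
open import Data.Nat.Properties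
open import Algebra.Properties.CommutativeSemigroup +-commutativeSemigroup using (x∙yz≈y∙xz)
open import Data.Fin using (Fin; toℕ; fromℕ<; inject₁) renaming (suc to fsuc; _≟_ to _≟ᶠ_)
open import Data.Fin.Properties using (toℕ-injective; toℕ-inject₁; toℕ-fromℕ<; toℕ<n)
open import Data.Fin.Permutation using (_⟨$⟩ʳ_; id) renaming (_≈_ to _≈ₚ_)
open import Data.List using (List; []; _∷_; _++_; _∷ʳ_; [_]; length; map; reverse)
open import Data.List.Properties
  using (++-assoc; ++-identityʳ; ∷ʳ-++; length-++; length-++-≤ˡ; length-map; length-reverse; map-++; unfold-reverse)
open import Data.List.Relation.Unary.All as All using (All; []; _∷_)
open import Data.List.Relation.Unary.All.Properties using (++⁺; map⁺; ¬Any⇒All¬; All¬⇒¬Any)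
open import Data.List.Relation.Unary.Any using (here; there)
open import Data.List.Relation.Unary.Any.Properties using (reverse⁻)
open import Data.List.Membership.Propositional using (_∈_; _∉_)
open import Data.List.Membership.Propositional.Properties using (∈-map⁺; ∈-++⁻)
open import Data.Product using (Σ; _×_; _,_; proj₁; proj₂)
open import Data.Sum using (_⊎_; inj₁; inj₂; [_,_]′)
open import Data.Empty using (⊥-elim)
open import Function using (_∘_)
open import Level using (0ℓ)
open import Relation.Binary using (Setoid; tri<; tri≈; tri>)
open import Relation.Binary.PropositionalEquality hiding ([_])
open import Relation.Nullary using (yes; no)
import Relation.Binary.Reasoning.Setoid as SetoidReasoning

-- Words are manipulated as lists of natural numbers, the letter k acting on ℕ as the
-- transposition (k k+1); toℕ-eval transfers the results to Perm m.
swap : ℕ → ℕ → ℕ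
swap zero    zero          = 1
swap zero    (suc zero)    = 0
swap zero    (suc (suc x)) = suc (suc x)
swap (suc k) zero          = zero
swap (suc k) (suc x)       = suc (swap k x)

swap-self : ∀ k → swap k k ≡ suc k
swap-self zero    = refl
swap-self (suc k) = cong suc (swap-self k)

swap-suc-self : ∀ k → swap k (suc k) ≡ k
swap-suc-self zero    = refl
swap-suc-self (suc k) = cong suc (swap-suc-self k)

swap-other : ∀ k x → x ≢ k → x ≢ suc k → swap k x ≡ x
swap-other zero    zero          x≢k _       = ⊥-elim (x≢k refl)
swap-other zero    (suc zero)    _   x≢k+1   = ⊥-elim (x≢k+1 refl)
swap-other zero    (suc (suc x)) _   _       = refl
swap-other (suc k) zero          _   _       = refl
swap-other (suc k) (suc x)       x≢k x≢k+1   = cong suc (swap-other k x (x≢k ∘ cong suc) (x≢k+1 ∘ cong suc))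

swap-involutive : ∀ k x → swap k (swap k x) ≡ x
swap-involutive zero    zero          = refl
swap-involutive zero    (suc zero)    = refl
swap-involutive zero    (suc (suc x)) = refl
swap-involutive (suc k) zero          = refl
swap-involutive (suc k) (suc x)       = cong suc (swap-involutive k x)

swap-braid : ∀ k x → swap k (swap (suc k) (swap k x)) ≡ swap (suc k) (swap k (swap (suc k) x))
swap-braid zero    zero                = refl
swap-braid zero    (suc zero)          = refl
swap-braid zero    (suc (suc zero))    = refl
swap-braid zero    (suc (suc (suc x))) = refl
swap-braid (suc k) zero                = refl
swap-braid (suc k) (suc x)             = cong suc (swap-braid k x)

swap-comm-< : ∀ {j k} → suc j < k → ∀ x → swap j (swap k x) ≡ swap k (swap j x)
swap-comm-< {zero}  {suc zero}    (s≤s ())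
swap-comm-< {zero}  {suc (suc k)} _         zero          = refl
swap-comm-< {zero}  {suc (suc k)} _         (suc zero)    = refl
swap-comm-< {zero}  {suc (suc k)} _         (suc (suc x)) = refl
swap-comm-< {suc j} {suc k}       _         zero          = refl
swap-comm-< {suc j} {suc k}       (s≤s j<k) (suc x)       = cong suc (swap-comm-< j<k x)

⟦_⟧ : List ℕ → ℕ → ℕ
⟦ []     ⟧ x = x
⟦ k ∷ ks ⟧ x = swap k (⟦ ks ⟧ x)

⟦++⟧ : ∀ ks ls x → ⟦ ks ++ ls ⟧ x ≡ ⟦ ks ⟧ (⟦ ls ⟧ x)
⟦++⟧ []       ls x = refl
⟦++⟧ (k ∷ ks) ls x = cong (swap k) (⟦++⟧ ks ls x)

infix 4 _≃_

-- A record rather than a pointwise equation, so that the two words can be inferred.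
record _≃_ (ks ls : List ℕ) : Set where
  constructor pointwise
  field
    pointwise-≡ : ∀ x → ⟦ ks ⟧ x ≡ ⟦ ls ⟧ x

open _≃_

≃-refl : ∀ {ks} → ks ≃ ks
≃-refl = pointwise (λ _ → refl)

≃-reflexive : ∀ {ks ls} → ks ≡ ls → ks ≃ ls
≃-reflexive refl = ≃-refl

≃-setoid : Setoid 0ℓ 0ℓ
≃-setoid = record
  { Carrier       = List ℕ
  ; _≈_           = _≃_
  ; isEquivalence = record
    { refl  = ≃-refl
    ; sym   = λ p → pointwise (λ x → sym (pointwise-≡ p x))
    ; trans = λ p q → pointwise (λ x → trans (pointwise-≡ p x) (pointwise-≡ q x))
    }
  }

module ≃-Reasoning = SetoidReasoning ≃-setoid

++-cong : ∀ {ks ks′ ls ls′} → ks ≃ ks′ → ls ≃ ls′ → ks ++ ls ≃ ks′ ++ ls′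
++-cong {ks} {ks′} {ls} {ls′} p q = pointwise λ x → begin
  ⟦ ks ++ ls ⟧ x      ≡⟨ ⟦++⟧ ks ls x ⟩
  ⟦ ks ⟧ (⟦ ls ⟧ x)   ≡⟨ pointwise-≡ p _ ⟩
  ⟦ ks′ ⟧ (⟦ ls ⟧ x)  ≡⟨ cong ⟦ ks′ ⟧ (pointwise-≡ q x) ⟩
  ⟦ ks′ ⟧ (⟦ ls′ ⟧ x) ≡⟨ ⟦++⟧ ks′ ls′ x ⟨
  ⟦ ks′ ++ ls′ ⟧ x    ∎
  where open ≡-Reasoning

++-congˡ : ∀ ks {ls ls′} → ls ≃ ls′ → ks ++ ls ≃ ks ++ ls′
++-congˡ ks = ++-cong ≃-refl

++-congʳ : ∀ {ks ks′} ls → ks ≃ ks′ → ks ++ ls ≃ ks′ ++ ls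
++-congʳ ls p = ++-cong p ≃-refl

Distant : ℕ → ℕ → Set
Distant j k = suc j < k ⊎ suc k < j

≃-involution : ∀ k → k ∷ k ∷ [] ≃ []
≃-involution k = pointwise (swap-involutive k)

≃-braid : ∀ k → k ∷ suc k ∷ k ∷ [] ≃ suc k ∷ k ∷ suc k ∷ []
≃-braid k = pointwise (swap-braid k)

≃-comm : ∀ {j k} → Distant j k → j ∷ k ∷ [] ≃ k ∷ j ∷ []
≃-comm (inj₁ j+1<k) = pointwise (swap-comm-< j+1<k)
≃-comm (inj₂ k+1<j) = pointwise (λ x → sym (swap-comm-< k+1<j x))

∷ʳ-∷ʳ : ∀ (ks : List ℕ) a b → ks ∷ʳ a ∷ʳ b ≡ ks ++ a ∷ b ∷ []
∷ʳ-∷ʳ ks a b = ++-assoc ks [ a ] [ b ]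

∷ʳ-∷ʳ-∷ʳ : ∀ (ks : List ℕ) a b c → ks ∷ʳ a ∷ʳ b ∷ʳ c ≡ ks ++ a ∷ b ∷ c ∷ []
∷ʳ-∷ʳ-∷ʳ ks a b c = trans (∷ʳ-∷ʳ (ks ∷ʳ a) b c) (∷ʳ-++ ks a (b ∷ c ∷ []))

length-∷ʳ : ∀ (ks : List ℕ) k → length (ks ∷ʳ k) ≡ suc (length ks)
length-∷ʳ ks k = trans (length-++ ks) (+-comm (length ks) 1)

∷ʳ-cancel : ∀ ks k → ks ∷ʳ k ∷ʳ k ≃ ks
∷ʳ-cancel ks k = begin
  ks ∷ʳ k ∷ʳ k       ≡⟨ ∷ʳ-∷ʳ ks k k ⟩
  ks ++ k ∷ k ∷ []   ≈⟨ ++-congˡ ks (≃-involution k) ⟩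
  ks ++ []           ≡⟨ ++-identityʳ ks ⟩
  ks                 ∎
  where open ≃-Reasoning

∷ʳ-comm : ∀ {j} ks → All (Distant j) ks → ks ∷ʳ j ≃ j ∷ ks
∷ʳ-comm         []       []           = ≃-refl
∷ʳ-comm {j} (k ∷ ks) (j~k ∷ j~ks) = begin
  k ∷ (ks ∷ʳ j) ≈⟨ ++-congˡ [ k ] (∷ʳ-comm ks j~ks) ⟩
  k ∷ j ∷ ks    ≈⟨ ++-congʳ ks (≃-comm j~k) ⟨
  j ∷ k ∷ ks    ∎
  where open ≃-Reasoning

++-comm : ∀ ks cs → All (λ c → All (Distant c) ks) cs → ks ++ cs ≃ cs ++ ks
++-comm ks []       []               = ≃-reflexive (++-identityʳ ks)
++-comm ks (c ∷ cs) (c~ks ∷ cs~ks) = begin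
  ks ++ c ∷ cs    ≡⟨ ∷ʳ-++ ks c cs ⟨
  ks ∷ʳ c ++ cs   ≈⟨ ++-congʳ cs (∷ʳ-comm ks c~ks) ⟩
  c ∷ ks ++ cs    ≈⟨ ++-congˡ [ c ] (++-comm ks cs cs~ks) ⟩
  c ∷ cs ++ ks    ∎
  where open ≃-Reasoning

distant-≥ : ∀ {j lo ks} → suc j < lo → All (lo ≤_) ks → All (Distant j) ks
distant-≥ j+1<lo = All.map (λ lo≤k → inj₁ (<-≤-trans j+1<lo lo≤k))

distant-≤ : ∀ {j hi ks} → suc hi < j → All (_≤ hi) ks → All (Distant j) ks
distant-≤ hi+1<j = All.map (λ k≤hi → inj₂ (≤-<-trans (s≤s k≤hi) hi+1<j))

-- Descending and ascending runs

down : ℕ → ℕ → List ℕ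
down r zero    = []
down r (suc n) = down (suc r) n ∷ʳ r

down-≥ : ∀ r n → All (r ≤_) (down r n)
down-≥ r zero    = []
down-≥ r (suc n) = ++⁺ (All.map <⇒≤ (down-≥ (suc r) n)) (≤-refl ∷ [])

down-≤ : ∀ r n → All (_≤ r + n) (down r (suc n))
down-≤ r zero    = ≤-reflexive (sym (+-identityʳ r)) ∷ []
down-≤ r (suc n) =
  ++⁺ (subst (λ t → All (_≤ t) (down (suc r) (suc n))) (sym (+-suc r n)) (down-≤ (suc r) n))
      (m≤m+n r (suc n) ∷ [])

down-desc : ∀ {r k} d → r + d ≡ k → down r (suc d) ≡ k ∷ desc k d
down-desc {r}     zero    r+0≡k   = cong [_] (trans (sym (+-identityʳ r)) r+0≡k)
down-desc {r} {k} (suc d) r+d+1≡k = cong₂ _∷ʳ_ (down-desc d (trans (sym (+-suc r d)) r+d+1≡k)) r≡k∸[d+1]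
  where
  r≡k∸[d+1] : r ≡ k ∸ suc d
  r≡k∸[d+1] = trans (sym (m+n∸n≡m r (suc d))) (cong (_∸ suc d) r+d+1≡k)

asc-> : ∀ i e → All (i <_) (asc i e)
asc-> i zero    = []
asc-> i (suc e) = ++⁺ (asc-> i e) (m<m+n i z<s ∷ [])

asc-≤ : ∀ i e → All (_≤ i + e) (asc i e)
asc-≤ i zero    = []
asc-≤ i (suc e) = ++⁺ (All.map (λ k≤i+e → ≤-trans k≤i+e (+-monoʳ-≤ i (n≤1+n e))) (asc-≤ i e)) (≤-refl ∷ [])

down-conj : ∀ {r y} n → r ≤ y → suc y < r + n → down r (suc n) ∷ʳ suc y ≃ y ∷ down r (suc n)
down-conj {r} {y} n r≤y y+1<r+n with m≤n⇒m<n∨m≡n r≤y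
down-conj {r} zero       r≤y y+1<r+n | _ =
  ⊥-elim (<⇒≱ y+1<r+n (≤-trans (≤-reflexive (+-identityʳ r)) (m≤n⇒m≤1+n r≤y)))
down-conj {r} (suc zero) r≤y y+1<r+n | _ =
  ⊥-elim (<⇒≱ y+1<r+n (≤-trans (≤-reflexive (+-comm r 1)) (s≤s r≤y)))
down-conj {r} {y} (suc (suc n)) r≤y y+1<r+n | inj₁ r<y = begin
  run ∷ʳ r ∷ʳ suc y       ≡⟨ ∷ʳ-∷ʳ run r (suc y) ⟩
  run ++ r ∷ suc y ∷ []   ≈⟨ ++-congˡ run (≃-comm (inj₁ (s≤s r<y))) ⟩
  run ++ suc y ∷ r ∷ []   ≡⟨ ∷ʳ-∷ʳ run (suc y) r ⟨
  run ∷ʳ suc y ∷ʳ r       ≈⟨ ++-congʳ [ r ] (down-conj (suc n) r<y (subst (suc y <_) (+-suc r (suc n)) y+1<r+n)) ⟩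
  y ∷ run ∷ʳ r            ∎
  where
  open ≃-Reasoning
  run : List ℕ
  run = down (suc r) (suc (suc n))
down-conj {r} (suc (suc n)) r≤y y+1<r+n | inj₂ refl = begin
  run ∷ʳ suc r ∷ʳ r ∷ʳ suc r        ≡⟨ ∷ʳ-∷ʳ-∷ʳ run (suc r) r (suc r) ⟩
  run ++ suc r ∷ r ∷ suc r ∷ []     ≈⟨ ++-congˡ run (≃-braid r) ⟨
  run ++ r ∷ suc r ∷ r ∷ []         ≡⟨ ∷ʳ-++ run r (suc r ∷ r ∷ []) ⟨
  run ∷ʳ r ++ suc r ∷ r ∷ []        ≈⟨ ++-congʳ (suc r ∷ r ∷ []) (∷ʳ-comm run r~run) ⟩
  r ∷ run ++ suc r ∷ r ∷ []         ≡⟨ cong (r ∷_) (∷ʳ-∷ʳ run (suc r) r) ⟨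
  r ∷ run ∷ʳ suc r ∷ʳ r             ∎
  where
  open ≃-Reasoning
  run : List ℕ
  run = down (suc (suc r)) (suc n)
  r~run : All (Distant r) run
  r~run = distant-≥ ≤-refl (down-≥ (suc (suc r)) (suc n))

asc-conj : ∀ {i j} e → i < j → j < i + e → asc i e ∷ʳ j ≃ suc j ∷ asc i e
asc-conj {i} {j} e i<j j<i+e with m≤n⇒m<n∨m≡n j<i+e
asc-conj {i} zero       i<j j<i+e | _ =
  ⊥-elim (<-asym i<j (<-≤-trans j<i+e (≤-reflexive (+-identityʳ i))))
asc-conj {i} (suc zero) i<j j<i+e | _ =
  ⊥-elim (<⇒≱ i<j (s≤s⁻¹ (≤-trans j<i+e (≤-reflexive (+-comm i 1)))))
asc-conj {i} {j} (suc (suc e)) i<j j<i+e | inj₁ j+1<top = begin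
  run ∷ʳ top ∷ʳ j       ≡⟨ ∷ʳ-∷ʳ run top j ⟩
  run ++ top ∷ j ∷ []   ≈⟨ ++-congˡ run (≃-comm (inj₂ j+1<top)) ⟩
  run ++ j ∷ top ∷ []   ≡⟨ ∷ʳ-∷ʳ run j top ⟨
  run ∷ʳ j ∷ʳ top       ≈⟨ ++-congʳ [ top ] (asc-conj (suc e) i<j j<i+e+1) ⟩
  suc j ∷ run ∷ʳ top    ∎
  where
  open ≃-Reasoning
  run : List ℕ
  run = asc i (suc e)
  top : ℕ
  top = i + suc (suc e)
  j<i+e+1 : j < i + suc e
  j<i+e+1 = s≤s⁻¹ (≤-trans j+1<top (≤-reflexive (+-suc i (suc e))))
asc-conj {i} {j} (suc (suc e)) i<j j<i+e | inj₂ j+1≡top = begin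
  run ∷ʳ (i + suc e) ∷ʳ top ∷ʳ j      ≡⟨ cong₂ (λ (a b : ℕ) → run ∷ʳ a ∷ʳ b ∷ʳ j) i+e+1≡j top≡j+1 ⟩
  run ∷ʳ j ∷ʳ suc j ∷ʳ j              ≡⟨ ∷ʳ-∷ʳ-∷ʳ run j (suc j) j ⟩
  run ++ j ∷ suc j ∷ j ∷ []           ≈⟨ ++-congˡ run (≃-braid j) ⟩
  run ++ suc j ∷ j ∷ suc j ∷ []       ≡⟨ ∷ʳ-++ run (suc j) (j ∷ suc j ∷ []) ⟨
  run ∷ʳ suc j ++ j ∷ suc j ∷ []      ≈⟨ ++-congʳ (j ∷ suc j ∷ []) (∷ʳ-comm run j+1~run) ⟩
  suc j ∷ run ++ j ∷ suc j ∷ []       ≡⟨ cong (suc j ∷_) (∷ʳ-∷ʳ run j (suc j)) ⟨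
  suc j ∷ run ∷ʳ j ∷ʳ suc j           ≡⟨ cong₂ (λ (a b : ℕ) → suc j ∷ run ∷ʳ a ∷ʳ b) i+e+1≡j top≡j+1 ⟨
  suc j ∷ run ∷ʳ (i + suc e) ∷ʳ top   ∎
  where
  open ≃-Reasoning
  run : List ℕ
  run = asc i e
  top : ℕ
  top = i + suc (suc e)
  top≡j+1 : top ≡ suc j
  top≡j+1 = sym j+1≡top
  i+e+1≡j : i + suc e ≡ j
  i+e+1≡j = suc-injective (trans (sym (+-suc i (suc e))) top≡j+1)
  j+1~run : All (Distant (suc j)) run
  j+1~run = distant-≤ (s≤s (≤-reflexive (trans (sym (+-suc i e)) i+e+1≡j))) (asc-≤ i e)

-- Absorbing letters into a normal form

record Factorisation {A : Set} (word : A → List ℕ) (Letter : ℕ → Set) (ks : List ℕ) : Set where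
  constructor factorisation
  field
    prefix         : List ℕ
    shape          : A
    prefix-letters : All Letter prefix
    no-longer      : length (prefix ++ word shape) ≤ length ks
    factorises     : ks ≃ prefix ++ word shape

absorb : ∀ {A Letter} {word : A → List ℕ} →
         (∀ a {j} → Letter j → Factorisation word Letter (word a ∷ʳ j)) →
         ∀ a {ks} → All Letter ks → Factorisation word Letter (word a ++ ks)
absorb {word = word} step a [] =
  factorisation [] a [] (≤-reflexive (cong length (sym (++-identityʳ (word a))))) (≃-reflexive (++-identityʳ (word a)))
absorb {word = word} step a {j ∷ ks} (j-letter ∷ ks-letters)
  with factorisation c₁ a₁ c₁-letters c₁-short a∷ʳj≃ ← step a j-letter
  with factorisation c₂ a₂ c₂-letters c₂-short a₁++ks≃ ← absorb step a₁ ks-letters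
  = factorisation (c₁ ++ c₂) a₂ (++⁺ c₁-letters c₂-letters) no-longer factorises
  where
  factorises : word a ++ j ∷ ks ≃ (c₁ ++ c₂) ++ word a₂
  factorises = begin
    word a ++ j ∷ ks          ≡⟨ ∷ʳ-++ (word a) j ks ⟨
    word a ∷ʳ j ++ ks         ≈⟨ ++-congʳ ks a∷ʳj≃ ⟩
    (c₁ ++ word a₁) ++ ks     ≡⟨ ++-assoc c₁ (word a₁) ks ⟩
    c₁ ++ word a₁ ++ ks       ≈⟨ ++-congˡ c₁ a₁++ks≃ ⟩
    c₁ ++ c₂ ++ word a₂       ≡⟨ ++-assoc c₁ c₂ (word a₂) ⟨
    (c₁ ++ c₂) ++ word a₂     ∎
    where open ≃-Reasoning
  no-longer : length ((c₁ ++ c₂) ++ word a₂) ≤ length (word a ++ j ∷ ks)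
  no-longer = begin
    length ((c₁ ++ c₂) ++ word a₂)     ≡⟨ cong length (++-assoc c₁ c₂ (word a₂)) ⟩
    length (c₁ ++ c₂ ++ word a₂)       ≡⟨ length-++ c₁ ⟩
    length c₁ + length (c₂ ++ word a₂) ≤⟨ +-monoʳ-≤ (length c₁) c₂-short ⟩
    length c₁ + length (word a₁ ++ ks) ≡⟨ length-++ c₁ ⟨
    length (c₁ ++ word a₁ ++ ks)       ≡⟨ cong length (++-assoc c₁ (word a₁) ks) ⟨
    length ((c₁ ++ word a₁) ++ ks)     ≡⟨ length-++ (c₁ ++ word a₁) ⟩
    length (c₁ ++ word a₁) + length ks ≤⟨ +-monoˡ-≤ (length ks) c₁-short ⟩
    length (word a ∷ʳ j) + length ks   ≡⟨ length-++ (word a ∷ʳ j) ⟨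
    length (word a ∷ʳ j ++ ks)         ≡⟨ cong length (∷ʳ-++ (word a) j ks) ⟩
    length (word a ++ j ∷ ks)          ∎
    where open ≤-Reasoning

record Descent (i : ℕ) : Set where
  constructor descent
  field
    bottom δ   : ℕ
    bottom+δ≡i : bottom + δ ≡ i

descentWord : ∀ {i} → Descent i → List ℕ
descentWord (descent r d _) = down r (suc d)

descent-≤ : ∀ {i} (D : Descent i) → All (_≤ i) (descentWord D)
descent-≤ (descent r d refl) = down-≤ r d

record Ascent (m i : ℕ) : Set where
  constructor ascent
  field
    δ     : ℕ
    i+δ<m : i + δ < m

ascentWord : ∀ {m i} → Ascent m i → List ℕ
ascentWord {i = i} (ascent e _) = asc i e

descent-step : ∀ {i j} (D : Descent i) → j < i → Factorisation descentWord (_< i) (descentWord D ∷ʳ j)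
descent-step {i} {j} (descent r d r+d≡i) j<i with <-cmp j r
... | tri< j<r _ _ with m≤n⇒m<n∨m≡n j<r
...   | inj₁ j+1<r = factorisation [ j ] (descent r d r+d≡i) (j<i ∷ [])
          (≤-reflexive (sym (length-∷ʳ (down r (suc d)) j)))
          (∷ʳ-comm (down r (suc d)) (distant-≥ j+1<r (down-≥ r (suc d))))
...   | inj₂ refl = factorisation [] (descent j (suc d) (trans (+-suc j d) r+d≡i)) [] ≤-refl ≃-refl
descent-step {i} {j} (descent r d r+d≡i) j<i | tri≈ _ refl _ with d
... | zero   = ⊥-elim (<-irrefl (trans (sym (+-identityʳ j)) r+d≡i) j<i)
... | suc d′ = factorisation [] (descent (suc j) d′ (trans (sym (+-suc j d′)) r+d≡i)) []
          (≤-trans (length-++-≤ˡ (down (suc j) (suc d′))) (length-++-≤ˡ (down j (suc (suc d′)))))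
          (∷ʳ-cancel (down (suc j) (suc d′)) j)
descent-step {i} {suc y} (descent r d r+d≡i) j<i | tri> _ _ r<j =
  factorisation [ y ] (descent r d r+d≡i) (<-trans (n<1+n y) j<i ∷ [])
    (≤-reflexive (sym (length-∷ʳ (down r (suc d)) (suc y))))
    (down-conj d (s≤s⁻¹ r<j) (subst (suc y <_) (sym r+d≡i) j<i))

ascent-step : ∀ {m i j} (U : Ascent m i) → i < j → j < m →
              Factorisation ascentWord (λ k → suc i < k × k < m) (ascentWord U ∷ʳ j)
ascent-step {m} {i} {j} (ascent e i+e<m) i<j j<m with <-cmp j (i + e)
... | tri< j<i+e _ _ = factorisation [ suc j ] (ascent e i+e<m) ((s≤s i<j , ≤-<-trans j<i+e i+e<m) ∷ [])
        (≤-reflexive (sym (length-∷ʳ (asc i e) j)))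
        (asc-conj e i<j j<i+e)
... | tri> _ _ i+e<j with m≤n⇒m<n∨m≡n i+e<j
...   | inj₁ i+e+1<j = factorisation [ j ] (ascent e i+e<m) ((≤-<-trans (s≤s (m≤m+n i e)) i+e+1<j , j<m) ∷ [])
          (≤-reflexive (sym (length-∷ʳ (asc i e) j)))
          (∷ʳ-comm (asc i e) (distant-≤ i+e+1<j (asc-≤ i e)))
...   | inj₂ i+e+1≡j = factorisation [] (ascent (suc e) (subst (_< m) (sym i+[e+1]≡j) j<m)) []
          (≤-reflexive (cong length (sym extended))) (≃-reflexive extended)
  where
  i+[e+1]≡j : i + suc e ≡ j
  i+[e+1]≡j = trans (+-suc i e) i+e+1≡j
  extended : asc i e ∷ʳ j ≡ asc i (suc e)
  extended = cong (asc i e ∷ʳ_) (sym i+[e+1]≡j)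
ascent-step {m} {i} (ascent e i+e<m) i<j j<m | tri≈ _ refl _ with e
... | zero   = ⊥-elim (<-irrefl (sym (+-identityʳ i)) i<j)
... | suc e′ = factorisation [] (ascent e′ (<-trans (+-monoʳ-< i (n<1+n e′)) i+e<m)) []
          (≤-trans (length-++-≤ˡ (asc i e′)) (length-++-≤ˡ (asc i (suc e′))))
          (∷ʳ-cancel (asc i e′) (i + suc e′))

-- The word of a shape (D , U) of Shape m i is s_i s_{i-1}⋯s_{i-δ⁻} s_{i+1}⋯s_{i+δ⁺},
-- with δ⁻ = Descent.δ D and δ⁺ = Ascent.δ U.
Shape : ℕ → ℕ → Set
Shape m i = Descent i × Ascent m i

shapeWord : ∀ {m i} → Shape m i → List ℕ
shapeWord (D , U) = descentWord D ++ ascentWord U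

shape-< : ∀ {m i} (V : Shape m i) → All (_< m) (shapeWord V)
shape-< {i = i} (D , ascent e i+e<m) =
  ++⁺ (All.map (λ k≤i → ≤-<-trans k≤i (≤-<-trans (m≤m+n i e) i+e<m)) (descent-≤ D))
      (All.map (λ k≤i+e → ≤-<-trans k≤i+e i+e<m) (asc-≤ i e))

Other : ℕ → ℕ → ℕ → Set
Other m i k = k < m × i ≢ k

shape-step-< : ∀ {m i j} (D : Descent i) (U : Ascent m i) → j < i →
               Factorisation shapeWord (Other m i) (shapeWord (D , U) ∷ʳ j)
shape-step-< {m} {i} {j} D U@(ascent e i+e<m) j<i
  with factorisation c D′ c<i short W∷ʳj≃ ← descent-step D j<i
  = factorisation c (D′ , U) (All.map (λ k<i → <-trans k<i (≤-<-trans (m≤m+n i e) i+e<m) , >⇒≢ k<i) c<i)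
      no-longer factorises
  where
  W : List ℕ
  W = descentWord D
  W′ : List ℕ
  W′ = descentWord D′
  factorises : (W ++ asc i e) ∷ʳ j ≃ c ++ W′ ++ asc i e
  factorises = begin
    (W ++ asc i e) ∷ʳ j   ≡⟨ ++-assoc W (asc i e) [ j ] ⟩
    W ++ asc i e ∷ʳ j     ≈⟨ ++-congˡ W (∷ʳ-comm (asc i e) (distant-≥ (s≤s j<i) (asc-> i e))) ⟩
    W ++ j ∷ asc i e      ≡⟨ ∷ʳ-++ W j (asc i e) ⟨
    W ∷ʳ j ++ asc i e     ≈⟨ ++-congʳ (asc i e) W∷ʳj≃ ⟩
    (c ++ W′) ++ asc i e  ≡⟨ ++-assoc c W′ (asc i e) ⟩
    c ++ W′ ++ asc i e    ∎
    where open ≃-Reasoning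
  no-longer : length (c ++ W′ ++ asc i e) ≤ length ((W ++ asc i e) ∷ʳ j)
  no-longer = begin
    length (c ++ W′ ++ asc i e)          ≡⟨ cong length (++-assoc c W′ (asc i e)) ⟨
    length ((c ++ W′) ++ asc i e)        ≡⟨ length-++ (c ++ W′) ⟩
    length (c ++ W′) + length (asc i e)  ≤⟨ +-monoˡ-≤ (length (asc i e)) short ⟩
    length (W ∷ʳ j) + length (asc i e)   ≡⟨ cong (_+ length (asc i e)) (length-∷ʳ W j) ⟩
    suc (length W + length (asc i e))    ≡⟨ cong suc (length-++ W) ⟨
    suc (length (W ++ asc i e))          ≡⟨ length-∷ʳ (W ++ asc i e) j ⟨
    length ((W ++ asc i e) ∷ʳ j)         ∎
    where open ≤-Reasoning

shape-step-> : ∀ {m i j} (D : Descent i) (U : Ascent m i) → i < j → j < m →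
               Factorisation shapeWord (Other m i) (shapeWord (D , U) ∷ʳ j)
shape-step-> {m} {i} {j} D U i<j j<m
  with factorisation c U′ c-letters short A∷ʳj≃ ← ascent-step U i<j j<m
  = factorisation c (D , U′) (All.map (λ (i+1<k , k<m) → k<m , <⇒≢ (<-trans (n<1+n i) i+1<k)) c-letters)
      no-longer factorises
  where
  W : List ℕ
  W = descentWord D
  A : List ℕ
  A = ascentWord U
  A′ : List ℕ
  A′ = ascentWord U′
  c~W : All (λ k → All (Distant k) W) c
  c~W = All.map (λ (i+1<k , _) → distant-≤ i+1<k (descent-≤ D)) c-letters
  factorises : (W ++ A) ∷ʳ j ≃ c ++ W ++ A′
  factorises = begin
    (W ++ A) ∷ʳ j    ≡⟨ ++-assoc W A [ j ] ⟩
    W ++ A ∷ʳ j      ≈⟨ ++-congˡ W A∷ʳj≃ ⟩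
    W ++ c ++ A′     ≡⟨ ++-assoc W c A′ ⟨
    (W ++ c) ++ A′   ≈⟨ ++-congʳ A′ (++-comm W c c~W) ⟩
    (c ++ W) ++ A′   ≡⟨ ++-assoc c W A′ ⟩
    c ++ W ++ A′     ∎
    where open ≃-Reasoning
  no-longer : length (c ++ W ++ A′) ≤ length ((W ++ A) ∷ʳ j)
  no-longer = begin
    length (c ++ W ++ A′)              ≡⟨ length-++ c ⟩
    length c + length (W ++ A′)        ≡⟨ cong (length c +_) (length-++ W) ⟩
    length c + (length W + length A′)  ≡⟨ x∙yz≈y∙xz (length c) (length W) (length A′) ⟩
    length W + (length c + length A′)  ≡⟨ cong (length W +_) (length-++ c) ⟨
    length W + length (c ++ A′)        ≤⟨ +-monoʳ-≤ (length W) short ⟩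
    length W + length (A ∷ʳ j)         ≡⟨ length-++ W ⟨
    length (W ++ A ∷ʳ j)               ≡⟨ cong length (++-assoc W A [ j ]) ⟨
    length ((W ++ A) ∷ʳ j)             ∎
    where open ≤-Reasoning

shape-step : ∀ {m i} (V : Shape m i) {j} → Other m i j → Factorisation shapeWord (Other m i) (shapeWord V ∷ʳ j)
shape-step (D , U) {j} (j<m , i≢j) with <-cmp j _
... | tri< j<i _ _ = shape-step-< D U j<i
... | tri≈ _ j≡i _ = ⊥-elim (i≢j (sym j≡i))
... | tri> _ _ i<j = shape-step-> D U i<j j<m

-- Permutations of Fin (suc m)

toℕ-s : ∀ {m} (k : Fin m) x → toℕ (s k ⟨$⟩ʳ x) ≡ swap (toℕ k) (toℕ x)
toℕ-s k x with x ≟ᶠ inject₁ k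
... | yes refl = trans (sym (swap-self (toℕ k))) (cong (swap (toℕ k)) (sym (toℕ-inject₁ k)))
... | no x≢k with x ≟ᶠ fsuc k
...   | yes refl = trans (toℕ-inject₁ k) (sym (swap-suc-self (toℕ k)))
...   | no x≢k+1 = sym (swap-other (toℕ k) (toℕ x)
                      (x≢k ∘ toℕ-injective ∘ (λ e → trans e (sym (toℕ-inject₁ k))))
                      (x≢k+1 ∘ toℕ-injective))

toℕ-eval : ∀ {m} (ws : Word m) x → toℕ (eval ws ⟨$⟩ʳ x) ≡ ⟦ map toℕ ws ⟧ (toℕ x)
toℕ-eval []       x = refl
toℕ-eval (k ∷ ws) x = trans (toℕ-s k _) (cong (swap (toℕ k)) (toℕ-eval ws x))

eval-cong : ∀ {m} {us vs : Word m} → map toℕ us ≃ map toℕ vs → eval us ≈ₚ eval vs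
eval-cong {us = us} {vs} us≃vs x =
  toℕ-injective (trans (toℕ-eval us x) (trans (pointwise-≡ us≃vs (toℕ x)) (sym (toℕ-eval vs x))))

eval-++ : ∀ {m} (us vs : Word m) → eval (us ++ vs) ≈ₚ eval us · eval vs
eval-++ []       vs x = refl
eval-++ (k ∷ us) vs x = cong (s k ⟨$⟩ʳ_) (eval-++ us vs x)

s-involutive : ∀ {m} (k : Fin m) → s k · s k ≈ₚ id
s-involutive k = eval-cong (≃-involution (toℕ k))

eval-reverse : ∀ {m} (ws : Word m) → eval (reverse ws) · eval ws ≈ₚ id
eval-reverse []       x = refl
eval-reverse {m} (k ∷ ws) x = begin
  eval (reverse (k ∷ ws)) ⟨$⟩ʳ (s k ⟨$⟩ʳ y)        ≡⟨ cong (λ vs → eval vs ⟨$⟩ʳ (s k ⟨$⟩ʳ y)) (unfold-reverse k ws) ⟩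
  eval (reverse ws ∷ʳ k) ⟨$⟩ʳ (s k ⟨$⟩ʳ y)         ≡⟨ eval-++ (reverse ws) [ k ] _ ⟩
  eval (reverse ws) ⟨$⟩ʳ (s k ⟨$⟩ʳ (s k ⟨$⟩ʳ y))   ≡⟨ cong (eval (reverse ws) ⟨$⟩ʳ_) (s-involutive k y) ⟩
  eval (reverse ws) ⟨$⟩ʳ y                         ≡⟨ eval-reverse ws x ⟩
  x                                               ∎
  where
  open ≡-Reasoning
  y : Fin (suc m)
  y = eval ws ⟨$⟩ʳ x

toWord : ∀ {m} (ks : List ℕ) → All (_< m) ks → Word m
toWord []       []           = []
toWord (k ∷ ks) (k<m ∷ ks<m) = fromℕ< k<m ∷ toWord ks ks<m

map-toℕ-toWord : ∀ {m} ks (ks<m : All (_< m) ks) → map toℕ (toWord ks ks<m) ≡ ks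
map-toℕ-toWord []       []           = refl
map-toℕ-toWord (k ∷ ks) (k<m ∷ ks<m) = cong₂ _∷_ (toℕ-fromℕ< k<m) (map-toℕ-toWord ks ks<m)

∉-toWord : ∀ {m} {i : Fin m} ks (ks<m : All (_< m) ks) → toℕ i ∉ ks → i ∉ toWord ks ks<m
∉-toWord {i = i} ks ks<m i∉ks i∈ = i∉ks (subst (toℕ i ∈_) (map-toℕ-toWord ks ks<m) (∈-map⁺ toℕ i∈))

mult≡0⇒∉ : ∀ {m} (i : Fin m) ws → mult i ws ≡ 0 → i ∉ ws
mult≡0⇒∉ i (j ∷ ws) mult≡0 i∈ with toℕ i ≟ toℕ j | i∈
... | no i≢j | here refl  = i≢j refl
... | no _   | there i∈ws = mult≡0⇒∉ i ws mult≡0 i∈ws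

mult≡1⇒split : ∀ {m} (i : Fin m) ws → mult i ws ≡ 1 →
               Σ (Word m) λ a → Σ (Word m) λ b → ws ≡ a ++ i ∷ b × i ∉ a × i ∉ b
mult≡1⇒split i (j ∷ ws) mult≡1 with toℕ i ≟ toℕ j
... | yes i≡j = [] , ws , cong (_∷ ws) (toℕ-injective (sym i≡j)) , (λ ()) , mult≡0⇒∉ i ws (suc-injective mult≡1)
... | no i≢j with mult≡1⇒split i ws mult≡1
...   | a , b , refl , i∉a , i∉b =
  j ∷ a , b , refl , (λ { (here i≡j) → i≢j (cong toℕ i≡j) ; (there i∈a) → i∉a i∈a }) , i∉b

record PivotFactorisation {m} (i : Fin m) (ws : Word m) : Set where
  constructor pivotFactorisation
  field
    prefix special : Word m
    δ⁻ δ⁺          : ℕ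
    i∉prefix       : i ∉ prefix
    δ⁻≤i           : δ⁻ ≤ toℕ i
    special-shape  : map toℕ special ≡ toℕ i ∷ (desc (toℕ i) δ⁻ ++ asc (toℕ i) δ⁺)
    no-longer      : length (prefix ++ special) ≤ length ws
    factorises     : eval ws ≈ₚ eval (prefix ++ special)

toPivotFactorisation : ∀ {m} (i : Fin m) ws →
                       Factorisation shapeWord (Other m (toℕ i)) (map toℕ ws) → PivotFactorisation i ws
toPivotFactorisation {m} i ws (factorisation c V@(descent r d r+d≡i , ascent e _) c-other short ws≃) =
  pivotFactorisation prefix special d e (∉-toWord c c<m (All¬⇒¬Any (All.map proj₂ c-other)))
    (subst (d ≤_) r+d≡i (m≤n+m d r)) special-shape no-longer
    (eval-cong (subst (map toℕ ws ≃_) (sym map-toℕ-split) ws≃))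
  where
  c<m : All (_< m) c
  c<m = All.map proj₁ c-other
  prefix : Word m
  prefix = toWord c c<m
  special : Word m
  special = toWord (shapeWord V) (shape-< V)
  special-shape : map toℕ special ≡ toℕ i ∷ (desc (toℕ i) d ++ asc (toℕ i) e)
  special-shape = trans (map-toℕ-toWord _ (shape-< V)) (cong (_++ asc (toℕ i) e) (down-desc d r+d≡i))
  map-toℕ-split : map toℕ (prefix ++ special) ≡ c ++ shapeWord V
  map-toℕ-split = trans (map-++ toℕ prefix special) (cong₂ _++_ (map-toℕ-toWord c c<m) (map-toℕ-toWord _ (shape-< V)))
  no-longer : length (prefix ++ special) ≤ length ws
  no-longer = begin
    length (prefix ++ special)          ≡⟨ length-map toℕ (prefix ++ special) ⟨
    length (map toℕ (prefix ++ special)) ≡⟨ cong length map-toℕ-split ⟩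
    length (c ++ shapeWord V)           ≤⟨ short ⟩
    length (map toℕ ws)                 ≡⟨ length-map toℕ ws ⟩
    length ws                           ∎
    where open ≤-Reasoning

pivotFactorisation-∷ : ∀ {m} (i : Fin m) b → i ∉ b → PivotFactorisation i (i ∷ b)
pivotFactorisation-∷ {m} i b i∉b = toPivotFactorisation i (i ∷ b) (absorb shape-step initial b-other)
  where
  initial : Shape m (toℕ i)
  initial = descent (toℕ i) 0 (+-identityʳ (toℕ i)) , ascent 0 (subst (_< m) (sym (+-identityʳ (toℕ i))) (toℕ<n i))
  b-other : All (Other m (toℕ i)) (map toℕ b)
  b-other = map⁺ (All.map (λ {k} i≢k → toℕ<n k , i≢k ∘ toℕ-injective) (¬Any⇒All¬ b i∉b))

pivotFactorisation-++ : ∀ {m} {i : Fin m} {ws} a → i ∉ a → PivotFactorisation i ws → PivotFactorisation i (a ++ ws)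
pivotFactorisation-++ {i = i} {ws} a i∉a (pivotFactorisation p v δ⁻ δ⁺ i∉p δ⁻≤i v-shape short ws≈pv) =
  pivotFactorisation (a ++ p) v δ⁻ δ⁺ ([ i∉a , i∉p ]′ ∘ ∈-++⁻ a) δ⁻≤i v-shape no-longer factorises
  where
  no-longer : length ((a ++ p) ++ v) ≤ length (a ++ ws)
  no-longer = begin
    length ((a ++ p) ++ v)     ≡⟨ cong length (++-assoc a p v) ⟩
    length (a ++ p ++ v)       ≡⟨ length-++ a ⟩
    length a + length (p ++ v) ≤⟨ +-monoʳ-≤ (length a) short ⟩
    length a + length ws       ≡⟨ length-++ a ⟨
    length (a ++ ws)           ∎
    where open ≤-Reasoning
  factorises : eval (a ++ ws) ≈ₚ eval ((a ++ p) ++ v)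
  factorises x = begin
    eval (a ++ ws) ⟨$⟩ʳ x               ≡⟨ eval-++ a ws x ⟩
    eval a ⟨$⟩ʳ (eval ws ⟨$⟩ʳ x)        ≡⟨ cong (eval a ⟨$⟩ʳ_) (ws≈pv x) ⟩
    eval a ⟨$⟩ʳ (eval (p ++ v) ⟨$⟩ʳ x)  ≡⟨ eval-++ a (p ++ v) x ⟨
    eval (a ++ p ++ v) ⟨$⟩ʳ x           ≡⟨ cong (λ us → eval us ⟨$⟩ʳ x) (++-assoc a p v) ⟨
    eval ((a ++ p) ++ v) ⟨$⟩ʳ x         ∎
    where open ≡-Reasoning

mult≡1⇒pivotFactorisation : ∀ {m} (i : Fin m) ws → mult i ws ≡ 1 → PivotFactorisation i ws
mult≡1⇒pivotFactorisation i ws mult≡1 with a , b , refl , i∉a , i∉b ← mult≡1⇒split i ws mult≡1 =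
  pivotFactorisation-++ a i∉a (pivotFactorisation-∷ i b i∉b)

-- Reduced words and the inverse of a prefix

eval-suffix : ∀ {m} {w : Perm m} p v → w ≈ₚ eval (p ++ v) → eval v ≈ₚ eval (reverse p) · w
eval-suffix {w = w} p v w≈pv x = begin
  eval v ⟨$⟩ʳ x                                         ≡⟨ eval-reverse p _ ⟨
  eval (reverse p) ⟨$⟩ʳ (eval p ⟨$⟩ʳ (eval v ⟨$⟩ʳ x))  ≡⟨ cong (eval (reverse p) ⟨$⟩ʳ_) (eval-++ p v x) ⟨
  eval (reverse p) ⟨$⟩ʳ (eval (p ++ v) ⟨$⟩ʳ x)         ≡⟨ cong (eval (reverse p) ⟨$⟩ʳ_) (w≈pv x) ⟨
  eval (reverse p) ⟨$⟩ʳ (w ⟨$⟩ʳ x)                     ∎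
  where open ≡-Reasoning

reverse-prefix-reduced : ∀ {m} {ws : Word m} {w} p v → Reduced ws w → w ≈ₚ eval (p ++ v) →
                         length (p ++ v) ≤ length ws → Reduced (reverse p) (eval (reverse p))
reverse-prefix-reduced {ws = ws} {w} p v (_ , ws-minimal) w≈pv short = (λ _ → refl) , minimal
  where
  minimal : ∀ us → eval us ≈ₚ eval (reverse p) → length (reverse p) ≤ length us
  minimal us us≈p⁻¹ = +-cancelʳ-≤ (length v) (length (reverse p)) (length us) p⁻¹v≤us⁻¹v
    where
    us⁻¹v≈w : eval (reverse us ++ v) ≈ₚ w
    us⁻¹v≈w x = begin
      eval (reverse us ++ v) ⟨$⟩ʳ x                              ≡⟨ eval-++ (reverse us) v x ⟩
      eval (reverse us) ⟨$⟩ʳ (eval v ⟨$⟩ʳ x)                     ≡⟨ cong (eval (reverse us) ⟨$⟩ʳ_) (eval-suffix {w = w} p v w≈pv x) ⟩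
      eval (reverse us) ⟨$⟩ʳ (eval (reverse p) ⟨$⟩ʳ (w ⟨$⟩ʳ x))  ≡⟨ cong (eval (reverse us) ⟨$⟩ʳ_) (us≈p⁻¹ _) ⟨
      eval (reverse us) ⟨$⟩ʳ (eval us ⟨$⟩ʳ (w ⟨$⟩ʳ x))           ≡⟨ eval-reverse us _ ⟩
      w ⟨$⟩ʳ x                                                  ∎
      where open ≡-Reasoning
    p⁻¹v≤us⁻¹v : length (reverse p) + length v ≤ length us + length v
    p⁻¹v≤us⁻¹v = begin
      length (reverse p) + length v  ≡⟨ cong (_+ length v) (length-reverse p) ⟩
      length p + length v            ≡⟨ length-++ p ⟨
      length (p ++ v)                ≤⟨ short ⟩
      length ws                      ≤⟨ ws-minimal (reverse us ++ v) us⁻¹v≈w ⟩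
      length (reverse us ++ v)       ≡⟨ length-++ (reverse us) ⟩
      length (reverse us) + length v ≡⟨ cong (_+ length v) (length-reverse us) ⟩
      length us + length v           ∎
      where open ≤-Reasoning

lemmaA4 : (m : ℕ) → 1 ≤ m → (i : Fin m) → (w : Perm m) →
    Σ (Word m) (λ ws → Reduced ws w × mult i ws ≡ 1) →
    Σ (Perm m) λ w′ →
    Σ (Word m) (λ vs → Reduced vs w′ × i ∉ vs) ×
    SpecialForm i (w′ · w)
lemmaA4 m _ i w (ws , ws-reduced@(ws≈w , _) , mult≡1)
  with pivotFactorisation p v δ⁻ δ⁺ i∉p δ⁻≤i v-shape short ws≈pv ← mult≡1⇒pivotFactorisation i ws mult≡1
  = eval (reverse p)
  , (reverse p , reverse-prefix-reduced {ws = ws} {w} p v ws-reduced w≈pv short , i∉p ∘ reverse⁻)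
  , (δ⁻ , δ⁺ , v , δ⁻≤i , v-shape , eval-suffix {w = w} p v w≈pv)
  where
  w≈pv : w ≈ₚ eval (p ++ v)
  w≈pv x = trans (sym (ws≈w x)) (ws≈pv x)
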